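{- Let $F$ be a graph of diameter $2$ with $n=|V(F)|$ and minimum degree $t=\delta(F)$, and let $l>n$ be an integer. Let $A_{2l-1}$ be the graph with vertex set $\{1,\dots,2l-1\}$ in which distinct $i,j$ are adjacent iff $|i-j|\le l-1$, and let $F_{2l}$ be obtained from $A_{2l-1}$ by adding a vertex $2l$ and the edges $(1,2l),\dots,(t,2l)$. Let $\delta_l=f_l-z_l$, where $z_l$ and $f_l$ are the $F$-degrees of vertex $l$ in $A_{2l-1}$ and in $F_{2l}$, respectively. Then $\delta_l\le n!\,C_{l-2}^{n-t-2}$.
   Context: All graphs are finite, simple and undirected. For graphs $F$ and $G$ and a vertex $v$ of $G$, the $F$-degree of $v$ in $G$ is the number of subgraphs of $G$ (not necessarily induced) that are isomorphic to $F$ and contain $v$. $\delta(F)$ is the minimum vertex degree of $F$. $C_m^k=\frac{m!}{k!(m-k)!}$ for integers $m\ge k\ge0$ and $C_m^k=0$ otherwise. -}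

module Defs where

open import Data.Bool using (Bool; true; false; _∧_; _∨_; not; if_then_else_)
open import Data.Nat using (ℕ; zero; suc; _+_; _∸_; _*_; _≤_; _≤ᵇ_; _<ᵇ_; _≡ᵇ_; ∣_-_∣)
open import Data.Nat.Combinatorics using (_C_)
open import Data.Integer using (ℤ; +_; -[1+_])
open import Data.Fin using (Fin; toℕ)
open import Data.Vec using (Vec; []; _∷_; lookup)
open import Data.List using (List; []; _∷_; concatMap; map; length; filterᵇ; allFin)
open import Data.Bool.ListAction using (all; any)
open import Data.Product using (_×_; _,_; Σ; ∃; ∃-syntax)
open import Data.Sum using (_⊎_)
open import Relation.Binary.PropositionalEquality using (_≡_; _≢_)

record Graph (n : ℕ) : Set where
  field
    adj   : Fin n → Fin n → Bool
    sym   : ∀ i j → adj i j ≡ adj j i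
    irrfl : ∀ i → adj i i ≡ false
open Graph public

allF : ∀ {k} → (Fin k → Bool) → Bool
allF {k} p = all p (allFin k)

anyF : ∀ {k} → (Fin k → Bool) → Bool
anyF {k} p = any p (allFin k)

_==F_ : ∀ {k} → Fin k → Fin k → Bool
i ==F j = toℕ i ≡ᵇ toℕ j

degree : ∀ {n} → Graph n → Fin n → ℕ
degree {n} F v = length (filterᵇ (adj F v) (allFin n))

IsMinDegree : ∀ {n} → Graph n → ℕ → Set
IsMinDegree {n} F t = (∃[ v ] degree F v ≡ t) × (∀ v → t ≤ degree F v)

HasDiameter2 : ∀ {n} → Graph n → Set
HasDiameter2 {n} F =
  (∀ u v → u ≢ v →
     (adj F u v ≡ true) ⊎ (∃[ w ] (adj F u w ≡ true × adj F w v ≡ true)))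
  × (∃[ u ] ∃[ v ] (u ≢ v × adj F u v ≡ false))

allVec : ∀ {A : Set} → List A → (k : ℕ) → List (Vec A k)
allVec xs zero = [] ∷ []
allVec xs (suc k) = concatMap (λ x → map (x ∷_) (allVec xs k)) xs

cartesian : ∀ {A B : Set} → List A → List B → List (A × B)
cartesian xs ys = concatMap (λ x → map (x ,_) ys) xs

-- Host graph on m vertices labelled 1..m; vertex i : Fin m has label toℕ i + 1,
-- and adjacency is given on labels by G : ℕ → ℕ → Bool.
-- A subgraph of the host is a pair (S , E) with S a vertex subset and E an edge
-- subset, the edge {i,j} with toℕ i < toℕ j being recorded in E[i][j]; the
-- representation is made canonical by requiring E[i][j] = true only when
-- toℕ i < toℕ j, i,j ∈ S and ij is an edge of the host.

VSub : ℕ → Set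
VSub m = Vec Bool m

ESub : ℕ → Set
ESub m = Vec (Vec Bool m) m

inS : ∀ {m} → VSub m → Fin m → Bool
inS S i = lookup S i

inE : ∀ {m} → ESub m → Fin m → Fin m → Bool
inE E i j = lookup (lookup E i) j

edgeE : ∀ {m} → ESub m → Fin m → Fin m → Bool
edgeE E i j = if toℕ i <ᵇ toℕ j then inE E i j
              else (if toℕ j <ᵇ toℕ i then inE E j i else false)

label : ∀ {m} → Fin m → ℕ
label i = suc (toℕ i)

IsSubgraphᵇ : ∀ {m} → (ℕ → ℕ → Bool) → VSub m × ESub m → Bool
IsSubgraphᵇ G (S , E) =
  allF (λ i → allF (λ j →
    not (inE E i j) ∨ ((toℕ i <ᵇ toℕ j) ∧ inS S i ∧ inS S j ∧ G (label i) (label j))))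

IsoToᵇ : ∀ {n m} → Graph n → VSub m × ESub m → Bool
IsoToᵇ {n} {m} F (S , E) = any isIso (allVec (allFin m) n)
  where
  isIso : Vec (Fin m) n → Bool
  isIso φ =
    allF (λ u → allF (λ w → (u ==F w) ∨ not (lookup φ u ==F lookup φ w)))
    ∧ allF (λ u → inS S (lookup φ u))
    ∧ allF (λ i → not (inS S i) ∨ anyF (λ u → lookup φ u ==F i))
    ∧ allF (λ u → allF (λ w →
        (adj F u w ∧ edgeE E (lookup φ u) (lookup φ w))
        ∨ (not (adj F u w) ∧ not (edgeE E (lookup φ u) (lookup φ w)))))

FDegree : ∀ {n} → Graph n → (m : ℕ) → (ℕ → ℕ → Bool) → ℕ → ℕ
FDegree {n} F m G v =
  length (filterᵇ ok (cartesian (allVec (true ∷ false ∷ []) m)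
                                (allVec (allVec (true ∷ false ∷ []) m) m)))
  where
  ok : VSub m × ESub m → Bool
  ok (S , E) = IsSubgraphᵇ G (S , E)
             ∧ anyF (λ i → inS S i ∧ (label i ≡ᵇ v))
             ∧ IsoToᵇ F (S , E)

A-adj : ℕ → ℕ → ℕ → Bool
A-adj l i j = not (i ≡ᵇ j) ∧ (∣ i - j ∣ ≤ᵇ l ∸ 1)

F-adj : ℕ → ℕ → ℕ → ℕ → Bool
F-adj l t i j =
  not (i ≡ᵇ j) ∧
    (((i ≤ᵇ 2 * l ∸ 1) ∧ (j ≤ᵇ 2 * l ∸ 1) ∧ (∣ i - j ∣ ≤ᵇ l ∸ 1))
     ∨ ((i ≡ᵇ 2 * l) ∧ (1 ≤ᵇ j) ∧ (j ≤ᵇ t))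
     ∨ ((j ≡ᵇ 2 * l) ∧ (1 ≤ᵇ i) ∧ (i ≤ᵇ t)))

-- binomial coefficient C_m^k with integer arguments, 0 unless m ≥ k ≥ 0
Cℤ : ℤ → ℤ → ℕ
Cℤ (+ m) (+ k) = m C k
Cℤ (+ m) -[1+ k ] = 0
Cℤ -[1+ m ] k = 0

{-# OPTIONS --safe #-}
module Submission where

-- Split the copies of F in F_{2l} that contain l according to whether they use the new
-- vertex 2l.  Restricting a copy that avoids 2l to {1, …, 2l−1} gives a copy in A_{2l−1},
-- since both host graphs agree there; this injection accounts for z_l.  In a copy through
-- 2l, let u₀ be the vertex of F sent to 2l.  The neighbours of 2l are 1, …, t, so the at
-- least t neighbours of u₀ fill {1, …, t}; every other vertex of F is a neighbour of u₀ or
-- adjacent to one, hence lands in {1, …, t+l−1}.  The image of F thus contains the t+2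
-- labels 1, …, t, l, 2l and its other n−t−2 labels lie among the l−2 remaining labels of
-- {t+1, …, t+l−1}.  Since the isomorphism determines the copy, there are at most
-- n!·C(l−2, n−t−2) copies through 2l.

open import Defs hiding (sym)
open import Data.Bool using (Bool; true; false; T; _∧_; _∨_; not; if_then_else_)
open import Data.Bool.Properties using (T-≡; T?; T-∧; T-∨; T-not-≡; ∧-identityʳ; ∧-zeroʳ)
open import Data.Empty using (⊥-elim)
open import Data.Fin using (Fin; toℕ; fromℕ; inject₁; lower₁; _≟_) renaming (zero to fzero; suc to fsuc)
open import Data.Fin.Properties
  using (toℕ-injective; toℕ-fromℕ; toℕ-inject₁; toℕ-lower₁; inject₁-lower₁; inject₁-injective; toℕ<n; all?; any?)
  renaming (suc-injective to fsuc-injective)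
open import Data.List
  using (List; []; _∷_; _++_; length; map; concatMap; filterᵇ; allFin; cartesianProductWith)
import Data.List
open import Data.List.Membership.Propositional using (_∈_; lose)
open import Data.List.Membership.Propositional.Properties
  using (∈-∃++; ∈-++⁻; ∈-++⁺ˡ; ∈-++⁺ʳ; ∈-filter⁻; ∈-filter⁺; ∈-allFin; ∈-cartesianProductWith⁺; ∈-cartesianProduct⁺)
open import Data.List.Properties
  using (length-filter; length-++-sucʳ; map-tabulate; filter-notAll; filter-some; length-tabulate)
open import Data.List.Relation.Unary.All as All using ([]; _∷_)
open import Data.List.Relation.Unary.All.Properties using (all⁺; all⁻)
open import Data.List.Relation.Unary.AllPairs using ([]; _∷_)
open import Data.List.Relation.Unary.Any using (here; there; satisfied)
open import Data.List.Relation.Unary.Any.Properties using (any⁺; any⁻)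
open import Data.List.Relation.Unary.Unique.Propositional using (Unique)
open import Data.List.Relation.Unary.Unique.Propositional.Properties
  using (filter⁺; cartesianProductWith⁺; cartesianProduct⁺; allFin⁺)
open import Data.Nat
  using (ℕ; zero; suc; _+_; _*_; _∸_; _≤_; _<_; _!; _≡ᵇ_; _<ᵇ_; ∣_-_∣; z≤n; s≤s; _≤?_)
open import Data.Nat.Combinatorics using (_C_; nC1≡n; nCk+nC[k+1]≡[n+1]C[k+1])
open import Data.Nat.ListAction using (sum)
open import Data.Nat.Properties
  using ( ≡ᵇ⇒≡; ≡⇒≡ᵇ; <ᵇ⇒<; <⇒<ᵇ; ≤ᵇ⇒≤; ≤⇒≤ᵇ; ≤-trans; ≤-reflexive; ≤-pred; <-trans; <-≤-trans; <⇒≤; <⇒≢; <⇒≱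
        ; 1+n≰n; ≰⇒>; n≤1+n; n<1+n; m≤m+n; m<n+m; m<n⇒m<1+n; m≤n⇒m≤1+n; m≤n+∣m-n∣; ∣-∣-comm; suc-injective
        ; +-suc; +-identityʳ; *-identityʳ; *-zeroʳ; *-distribˡ-+; +-mono-≤; +-monoˡ-≤; +-monoʳ-≤; +-cancelʳ-≡
        ; m+[n∸m]≡n; m+n∸m≡n; ∸-monoˡ-≤; ∸-+-assoc; module ≤-Reasoning)
  renaming (_≟_ to _≟ℕ_)
open import Data.Nat.Tactic.RingSolver using (solve-∀)
open import Data.Product using (∃; ∃-syntax; _×_; _,_; proj₁; proj₂)
open import Data.Sum using (_⊎_; inj₁; inj₂; swap)
import Data.Sum
open import Data.Vec using (Vec; []; _∷_; lookup; tabulate)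
open import Data.Vec.Properties using (∷-injective; tabulate∘lookup; tabulate-cong; lookup∘tabulate)
open import Function using (_∘_; _⇔_; mk⇔; Equivalence)
open import Relation.Binary.Definitions using (DecidableEquality)
open import Relation.Binary.PropositionalEquality
  using (_≡_; _≢_; refl; sym; trans; cong; cong₂; subst; subst₂; module ≡-Reasoning)
open import Relation.Nullary using (¬_; Dec; yes; no)
open import Relation.Nullary.Decidable using (⌊_⌋; toWitness; fromWitness; _×-dec_; _→-dec_)

open Equivalence using (to; from)

count : {A : Set} → (A → Bool) → List A → ℕ
count p xs = length (filterᵇ p xs)

module _ {A : Set} where

  count-cong : ∀ {p q : A → Bool} xs → (∀ x → x ∈ xs → p x ≡ q x) → count p xs ≡ count q xs
  count-cong [] _ = refl
  count-cong {p} {q} (x ∷ xs) p≗q with p x | q x | p≗q x (here refl)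
  ... | true  | true  | refl = cong suc (count-cong xs (λ y → p≗q y ∘ there))
  ... | false | false | refl = count-cong xs (λ y → p≗q y ∘ there)

  count-none : ∀ {p : A → Bool} → (∀ x → ¬ T (p x)) → ∀ xs → count p xs ≡ 0
  count-none none [] = refl
  count-none {p} none (x ∷ xs) with p x | none x
  ... | true  | ¬px = ⊥-elim (¬px _)
  ... | false | _   = count-none none xs

  count-witness : ∀ (p : A → Bool) xs {k} → count p xs ≡ suc k → ∃ λ x → T (p x)
  count-witness p (x ∷ xs) eq with p x in px
  ... | true  = x , from T-≡ px
  ... | false = count-witness p xs eq

  count-mono : ∀ {p q : A → Bool} → (∀ x → T (p x) → T (q x)) → ∀ xs → count p xs ≤ count q xs
  count-mono p⇒q [] = z≤n
  count-mono {p} {q} p⇒q (x ∷ xs) with p x | q x | p⇒q x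
  ... | true  | true  | _   = s≤s (count-mono p⇒q xs)
  ... | true  | false | p⇒q = ⊥-elim (p⇒q _)
  ... | false | true  | _   = m≤n⇒m≤1+n (count-mono p⇒q xs)
  ... | false | false | _   = count-mono p⇒q xs

  count-split : ∀ (p q : A → Bool) xs →
    count p xs ≡ count (λ x → p x ∧ not (q x)) xs + count (λ x → p x ∧ q x) xs
  count-split p q [] = refl
  count-split p q (x ∷ xs) with p x | q x
  ... | true  | true  = trans (cong suc (count-split p q xs)) (sym (+-suc _ _))
  ... | true  | false = cong suc (count-split p q xs)
  ... | false | _     = count-split p q xs

  count-∨ : ∀ {p q : A → Bool} → (∀ x → T (p x) → ¬ T (q x)) → ∀ xs →
    count (λ x → p x ∨ q x) xs ≡ count p xs + count q xs
  count-∨ disjoint [] = refl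
  count-∨ {p} {q} disjoint (x ∷ xs) with p x | q x | disjoint x
  ... | true  | true  | disj = ⊥-elim (disj _ _)
  ... | true  | false | _    = cong suc (count-∨ disjoint xs)
  ... | false | true  | _    = trans (cong suc (count-∨ disjoint xs)) (sym (+-suc _ _))
  ... | false | false | _    = count-∨ disjoint xs

  count-map : ∀ {B : Set} (p : A → Bool) (f : B → A) xs → count p (map f xs) ≡ count (p ∘ f) xs
  count-map p f [] = refl
  count-map p f (x ∷ xs) with p (f x)
  ... | true  = cong suc (count-map p f xs)
  ... | false = count-map p f xs

  count-++ : ∀ (p : A → Bool) xs ys → count p (xs ++ ys) ≡ count p xs + count p ys
  count-++ p [] ys = refl
  count-++ p (x ∷ xs) ys with p x
  ... | true  = cong suc (count-++ p xs ys)
  ... | false = count-++ p xs ys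

  count-concatMap-≤ : ∀ {B : Set} (p : A → Bool) (g : B → List A) (f : B → ℕ) →
    (∀ x → count p (g x) ≤ f x) → ∀ xs → count p (concatMap g xs) ≤ sum (map f xs)
  count-concatMap-≤ p g f bound [] = z≤n
  count-concatMap-≤ p g f bound (x ∷ xs) = begin
    count p (g x ++ concatMap g xs)           ≡⟨ count-++ p (g x) (concatMap g xs) ⟩
    count p (g x) + count p (concatMap g xs)  ≤⟨ +-mono-≤ (bound x) (count-concatMap-≤ p g f bound xs) ⟩
    f x + sum (map f xs)                      ∎
    where open ≤-Reasoning

  sum-+ : ∀ (f g : A → ℕ) xs → sum (map (λ x → f x + g x) xs) ≡ sum (map f xs) + sum (map g xs)
  sum-+ f g [] = refl
  sum-+ f g (x ∷ xs) = trans (cong (λ s → f x + g x + s) (sum-+ f g xs)) (interchange (f x) (g x) _ _)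
    where
    interchange : ∀ a b c d → a + b + (c + d) ≡ (a + c) + (b + d)
    interchange = solve-∀

  sum-if : ∀ (p : A → Bool) c xs → sum (map (λ x → if p x then c else 0) xs) ≡ count p xs * c
  sum-if p c [] = refl
  sum-if p c (x ∷ xs) with p x
  ... | true  = cong (c +_) (sum-if p c xs)
  ... | false = sum-if p c xs

module _ {A : Set} (_≟_ : DecidableEquality A) where

  count-remove : ∀ (p : A → Bool) {x} xs → Unique xs → x ∈ xs → T (p x) →
    suc (count (λ y → p y ∧ not ⌊ y ≟ x ⌋) xs) ≡ count p xs
  count-remove p (y ∷ ys) (y∉ys ∷ _) (here refl) py with p y | y ≟ y
  ... | true  | yes _  = cong suc (count-cong ys λ z z∈ys → kept z (All.lookup y∉ys z∈ys))
    where
    kept : ∀ z → y ≢ z → p z ∧ not ⌊ z ≟ y ⌋ ≡ p z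
    kept z y≢z with z ≟ y
    ... | yes z≡y = ⊥-elim (y≢z (sym z≡y))
    ... | no  _   = ∧-identityʳ (p z)
  ... | true  | no y≢y = ⊥-elim (y≢y refl)
  count-remove p {x} (y ∷ ys) (y∉ys ∷ uys) (there x∈ys) px with y ≟ x
  ... | yes refl = ⊥-elim (All.lookup y∉ys x∈ys refl)
  ... | no _ with p y
  ...   | true  = cong suc (count-remove p ys uys x∈ys px)
  ...   | false = count-remove p ys uys x∈ys px

module _ {A B : Set} where

  private
    ∈-skip : ∀ {y z : B} us {vs} → y ∈ us ++ z ∷ vs → y ≢ z → y ∈ us ++ vs
    ∈-skip us y∈ y≢z with ∈-++⁻ us y∈
    ... | inj₁ y∈us         = ∈-++⁺ˡ y∈us
    ... | inj₂ (here y≡z)   = ⊥-elim (y≢z y≡z)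
    ... | inj₂ (there y∈vs) = ∈-++⁺ʳ us y∈vs

  length-≤-injection : ∀ {xs : List A} {ys : List B} → Unique xs →
    (f : ∀ {x} → x ∈ xs → B) → (∀ {x} (x∈xs : x ∈ xs) → f x∈xs ∈ ys) →
    (∀ {x y} (x∈xs : x ∈ xs) (y∈xs : y ∈ xs) → f x∈xs ≡ f y∈xs → x ≡ y) →
    length xs ≤ length ys
  length-≤-injection {[]} _ _ _ _ = z≤n
  length-≤-injection {x ∷ xs} (x∉xs ∷ uxs) f f∈ys inj with ∈-∃++ (f∈ys (here refl))
  ... | us , vs , refl = begin
    suc (length xs)          ≤⟨ s≤s (length-≤-injection uxs (f ∘ there) f∈us++vs (λ p q → inj (there p) (there q))) ⟩
    suc (length (us ++ vs))  ≡⟨ length-++-sucʳ us _ vs ⟨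
    length (us ++ _ ∷ vs)    ∎
    where
    open ≤-Reasoning
    f∈us++vs : ∀ {y} (y∈xs : y ∈ xs) → f (there y∈xs) ∈ us ++ vs
    f∈us++vs y∈xs = ∈-skip us (f∈ys (there y∈xs))
      λ eq → All.lookup x∉xs y∈xs (sym (inj (there y∈xs) (here refl) eq))

  count-≤-injection : ∀ {p : A → Bool} {q : B → Bool} {xs ys} → Unique xs → (∀ y → y ∈ ys) →
    (f : ∀ x → T (p x) → B) → (∀ x px → T (q (f x px))) →
    (∀ x y px py → f x px ≡ f y py → x ≡ y) → count p xs ≤ count q ys
  count-≤-injection {p} {q} {xs} uxs ys-complete f f-q f-inj =
    length-≤-injection (filter⁺ (T? ∘ p) uxs) g
      (λ _ → ∈-filter⁺ (T? ∘ q) (ys-complete _) (f-q _ _))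
      (λ _ _ → f-inj _ _ _ _)
    where
    g : ∀ {x} → x ∈ filterᵇ p xs → B
    g {x} x∈ = f x (proj₂ (∈-filter⁻ (T? ∘ p) {xs = xs} x∈))

#_ : ∀ {m} → (Fin m → Bool) → ℕ
#_ {m} P = count P (allFin m)

below is : ∀ {m} → ℕ → Fin m → Bool
below b i = toℕ i <ᵇ b
is c i = toℕ i ≡ᵇ c

below⇒< : ∀ {m b} (i : Fin m) → T (below b i) → toℕ i < b
below⇒< {b = b} i = <ᵇ⇒< (toℕ i) b

is⇒≡ : ∀ {m c} (i : Fin m) → T (is c i) → toℕ i ≡ c
is⇒≡ {c = c} i = ≡ᵇ⇒≡ (toℕ i) c

count-tabulate-fsuc : ∀ {m} (P : Fin (suc m) → Bool) → count P (Data.List.tabulate fsuc) ≡ # (P ∘ fsuc)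
count-tabulate-fsuc {m} P = trans (cong (count P) (sym (map-tabulate (λ i → i) fsuc))) (count-map P fsuc (allFin m))

#below : ∀ {m} b → b ≤ m → # below {m} b ≡ b
#below {m}     zero    _         = count-none (λ _ ()) (allFin m)
#below {suc m} (suc b) (s≤s b≤m) = cong suc (trans (count-tabulate-fsuc {m} (below (suc b))) (#below b b≤m))

#is : ∀ {m} c → c < m → # is {m} c ≡ 1
#is {suc m} zero    _         = cong suc (trans (count-tabulate-fsuc {m} (is 0)) (count-none (λ _ ()) (allFin m)))
#is {suc m} (suc c) (s≤s c<m) = trans (count-tabulate-fsuc {m} (is (suc c))) (#is c c<m)

module _ {m : ℕ} where

  remove : (Fin m → Bool) → Fin m → Fin m → Bool
  remove P x y = P y ∧ not ⌊ y ≟ x ⌋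

  T-remove : ∀ P x y → T (remove P x y) ⇔ (T (P y) × y ≢ x)
  T-remove P x y with y ≟ x
  ... | yes refl = mk⇔ (λ h → proj₁ (to T-∧ h) , λ _ → proj₂ (to T-∧ h)) (λ (_ , x≢x) → ⊥-elim (x≢x refl))
  ... | no  y≢x  = mk⇔ (λ h → proj₁ (to T-∧ h) , y≢x) (λ (Py , _) → from T-∧ (Py , _))

  #remove : ∀ P {x} → T (P x) → # remove P x ≡ # P ∸ 1
  #remove P {x} Px = cong (_∸ 1) (count-remove _≟_ P (allFin m) (allFin⁺ m) (∈-allFin x) Px)

onto-by-counting : ∀ {n m} (p : Fin n → Bool) (q : Fin m → Bool) (f : Fin n → Fin m) →
  (∀ x → T (p x) → T (q (f x))) → (∀ x y → T (p x) → T (p y) → f x ≡ f y → x ≡ y) →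
  # q ≤ # p → ∀ y → T (q y) → ∃[ x ] T (p x) × f x ≡ y
onto-by-counting {n} {m} p q f f-q f-inj #q≤#p y qy with any? (λ x → T? (p x) ×-dec (f x ≟ y))
... | yes found = found
... | no  none  = ⊥-elim (1+n≰n (begin
  suc (# remove q y)  ≡⟨ count-remove _≟_ q (allFin m) (allFin⁺ m) (∈-allFin y) qy ⟩
  # q                 ≤⟨ #q≤#p ⟩
  # p                 ≤⟨ count-≤-injection (allFin⁺ n) ∈-allFin (λ x _ → f x) misses-y f-inj ⟩
  # remove q y        ∎))
  where
  open ≤-Reasoning
  misses-y : ∀ x → T (p x) → T (remove q y (f x))
  misses-y x px = from (T-remove q y (f x)) (f-q x px , λ fx≡y → none (x , px , fx≡y))

module _ {A B C : Set} (f : A → B → C) where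

  concatMap≡cartesianProductWith : ∀ xs ys → concatMap (λ x → map (f x) ys) xs ≡ cartesianProductWith f xs ys
  concatMap≡cartesianProductWith []       ys = refl
  concatMap≡cartesianProductWith (x ∷ xs) ys = cong (map (f x) ys ++_) (concatMap≡cartesianProductWith xs ys)

module _ {A : Set} {xs : List A} where

  allVec-unique : Unique xs → ∀ k → Unique (allVec xs k)
  allVec-unique _   zero    = [] ∷ []
  allVec-unique uxs (suc k) =
    subst Unique (sym (concatMap≡cartesianProductWith _∷_ xs (allVec xs k)))
      (cartesianProductWith⁺ _∷_ ∷-injective uxs (allVec-unique uxs k))

  ∈-allVec : (∀ x → x ∈ xs) → ∀ {k} (v : Vec A k) → v ∈ allVec xs k
  ∈-allVec xs-complete []      = here refl
  ∈-allVec xs-complete (x ∷ v) =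
    subst (x ∷ v ∈_) (sym (concatMap≡cartesianProductWith _∷_ xs (allVec xs _)))
      (∈-cartesianProductWith⁺ _∷_ (xs-complete x) (∈-allVec xs-complete v))

bools : List Bool
bools = true ∷ false ∷ []

candidates : ∀ m → List (VSub m × ESub m)
candidates m = cartesian (allVec bools m) (allVec (allVec bools m) m)

private
  bools-unique : Unique bools
  bools-unique = ((λ ()) ∷ []) ∷ [] ∷ []

  ∈-bools : ∀ b → b ∈ bools
  ∈-bools true  = here refl
  ∈-bools false = there (here refl)

candidates-unique : ∀ m → Unique (candidates m)
candidates-unique m =
  subst Unique (sym (concatMap≡cartesianProductWith _,_ (allVec bools m) (allVec (allVec bools m) m)))
    (cartesianProduct⁺ (allVec-unique bools-unique m) (allVec-unique (allVec-unique bools-unique m) m))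

∈-candidates : ∀ {m} (SE : VSub m × ESub m) → SE ∈ candidates m
∈-candidates {m} (S , E) =
  subst ((S , E) ∈_) (sym (concatMap≡cartesianProductWith _,_ (allVec bools m) (allVec (allVec bools m) m)))
    (∈-cartesianProduct⁺ (∈-allVec ∈-bools S) (∈-allVec (∈-allVec ∈-bools) E))

[n+1]*nCk≡[k+1]*[n+1]C[k+1] : ∀ n k → suc n * (n C k) ≡ suc k * (suc n C suc k)
[n+1]*nCk≡[k+1]*[n+1]C[k+1] n       zero    = trans (*-identityʳ (suc n)) (sym (trans (+-identityʳ _) (nC1≡n (suc n))))
[n+1]*nCk≡[k+1]*[n+1]C[k+1] zero    (suc k) = sym (*-zeroʳ (suc (suc k)))
[n+1]*nCk≡[k+1]*[n+1]C[k+1] (suc n) (suc k) = begin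
  X + suc n * X                                ≡⟨ cong (λ z → X + suc n * z) (nCk+nC[k+1]≡[n+1]C[k+1] n k) ⟨
  X + suc n * (n C k + n C suc k)              ≡⟨ cong (X +_) (*-distribˡ-+ (suc n) (n C k) (n C suc k)) ⟩
  X + (suc n * (n C k) + suc n * (n C suc k))  ≡⟨ cong₂ (λ u v → X + (u + v)) ([n+1]*nCk≡[k+1]*[n+1]C[k+1] n k)
                                                                            ([n+1]*nCk≡[k+1]*[n+1]C[k+1] n (suc k)) ⟩
  X + (suc k * X + suc (suc k) * Y)            ≡⟨ regroup X Y k ⟩
  suc (suc k) * (X + Y)                        ≡⟨ cong (suc (suc k) *_) (nCk+nC[k+1]≡[n+1]C[k+1] (suc n) (suc k)) ⟩
  suc (suc k) * (suc (suc n) C suc (suc k))    ∎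
  where
  open ≡-Reasoning
  X Y : ℕ
  X = suc n C suc k
  Y = suc n C suc (suc k)
  regroup : ∀ X Y k → X + (suc k * X + suc (suc k) * Y) ≡ suc (suc k) * (X + Y)
  regroup = solve-∀

n*[n∸1]Ck≡[k+1]*nC[k+1] : ∀ n k → n * ((n ∸ 1) C k) ≡ suc k * (n C suc k)
n*[n∸1]Ck≡[k+1]*nC[k+1] zero    k = sym (*-zeroʳ (suc k))
n*[n∸1]Ck≡[k+1]*nC[k+1] (suc n) k = [n+1]*nCk≡[k+1]*[n+1]C[k+1] n k

-- The number of injective k-tuples drawn from a + b points whose image contains a given a of
-- them: the first entry is either one of those a points or one of the other b.
arrangements : ℕ → ℕ → ℕ → ℕ
arrangements zero    zero    b = 1
arrangements zero    (suc a) b = 0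
arrangements (suc k) a       b = a * arrangements k (a ∸ 1) b + b * arrangements k a (b ∸ 1)

arrangements-< : ∀ {k a} b → k < a → arrangements k a b ≡ 0
arrangements-< {zero}  {suc a} b _ = refl
arrangements-< {suc k} {suc a} b (s≤s k<a)
  rewrite arrangements-< b k<a | arrangements-< (b ∸ 1) (m<n⇒m<1+n k<a) =
  cong₂ _+_ (*-zeroʳ (suc a)) (*-zeroʳ b)

arrangements-+ : ∀ a j b → arrangements (a + j) a b ≡ (a + j) ! * (b C j)
arrangements-+ zero    zero    b = refl
arrangements-+ zero    (suc j) b = begin
  b * arrangements j 0 (b ∸ 1)        ≡⟨ cong (b *_) (arrangements-+ zero j (b ∸ 1)) ⟩
  b * (j ! * ((b ∸ 1) C j))           ≡⟨ x*[y*z]≡y*[x*z] b (j !) _ ⟩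
  j ! * (b * ((b ∸ 1) C j))           ≡⟨ cong (j ! *_) (n*[n∸1]Ck≡[k+1]*nC[k+1] b j) ⟩
  j ! * (suc j * (b C suc j))         ≡⟨ x*[y*z]≡y*x*z (j !) (suc j) _ ⟩
  suc j ! * (b C suc j)               ∎
  where
  open ≡-Reasoning
  x*[y*z]≡y*[x*z] : ∀ x y z → x * (y * z) ≡ y * (x * z)
  x*[y*z]≡y*[x*z] = solve-∀
  x*[y*z]≡y*x*z : ∀ x y z → x * (y * z) ≡ y * x * z
  x*[y*z]≡y*x*z = solve-∀
arrangements-+ (suc a) zero    b = begin
  suc a * arrangements (a + 0) a b + b * arrangements (a + 0) (suc a) (b ∸ 1)
    ≡⟨ cong₂ (λ u v → suc a * u + b * v) (arrangements-+ a zero b)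
                                         (arrangements-< (b ∸ 1) (s≤s (≤-reflexive (+-identityʳ a)))) ⟩
  suc a * ((a + 0) ! * (b C 0)) + b * 0
    ≡⟨ collect a ((a + 0) !) b ⟩
  suc (a + 0) ! * (b C 0)             ∎
  where
  open ≡-Reasoning
  collect : ∀ a f b → suc a * (f * 1) + b * 0 ≡ suc (a + 0) * f * 1
  collect = solve-∀
arrangements-+ (suc a) (suc j) b = begin
  suc a * arrangements N a b + b * arrangements N (suc a) (b ∸ 1)
    ≡⟨ cong₂ (λ u v → suc a * u + b * v) (arrangements-+ a (suc j) b) last-in-optional ⟩
  suc a * (N ! * (b C suc j)) + b * (N ! * ((b ∸ 1) C j))
    ≡⟨ cong (λ z → suc a * (N ! * (b C suc j)) + z) (x*[y*z]≡y*[x*z] b (N !) _) ⟩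
  suc a * (N ! * (b C suc j)) + N ! * (b * ((b ∸ 1) C j))
    ≡⟨ cong (λ z → suc a * (N ! * (b C suc j)) + N ! * z) (n*[n∸1]Ck≡[k+1]*nC[k+1] b j) ⟩
  suc a * (N ! * (b C suc j)) + N ! * (suc j * (b C suc j))
    ≡⟨ collect a j (N !) (b C suc j) ⟩
  suc N ! * (b C suc j)               ∎
  where
  open ≡-Reasoning
  N : ℕ
  N = a + suc j
  last-in-optional : arrangements N (suc a) (b ∸ 1) ≡ N ! * ((b ∸ 1) C j)
  last-in-optional = begin
    arrangements N (suc a) (b ∸ 1)           ≡⟨ cong (λ k → arrangements k (suc a) (b ∸ 1)) (+-suc a j) ⟩
    arrangements (suc a + j) (suc a) (b ∸ 1) ≡⟨ arrangements-+ (suc a) j (b ∸ 1) ⟩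
    (suc a + j) ! * ((b ∸ 1) C j)            ≡⟨ cong (λ k → k ! * ((b ∸ 1) C j)) (+-suc a j) ⟨
    N ! * ((b ∸ 1) C j)                      ∎
  x*[y*z]≡y*[x*z] : ∀ x y z → x * (y * z) ≡ y * (x * z)
  x*[y*z]≡y*[x*z] = solve-∀
  collect : ∀ a j f c → suc a * (f * c) + f * (suc j * c) ≡ suc (a + suc j) * f * c
  collect = solve-∀

module _ {m : ℕ} where

  IsArrangement : (K W : Fin m → Bool) → ∀ {k} → Vec (Fin m) k → Set
  IsArrangement K W v =
    (∀ u w → lookup v u ≡ lookup v w → u ≡ w)
    × (∀ u → T (K (lookup v u) ∨ W (lookup v u)))
    × (∀ i → T (K i) → ∃[ u ] lookup v u ≡ i)

  isArrangement? : ∀ K W {k} (v : Vec (Fin m) k) → Dec (IsArrangement K W v)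
  isArrangement? K W v =
    all? (λ u → all? λ w → (lookup v u ≟ lookup v w) →-dec (u ≟ w))
    ×-dec all? (λ u → T? (K (lookup v u) ∨ W (lookup v u)))
    ×-dec all? (λ i → T? (K i) →-dec any? (λ u → lookup v u ≟ i))

  isArrangement : (K W : Fin m → Bool) → ∀ {k} → Vec (Fin m) k → Bool
  isArrangement K W v = ⌊ isArrangement? K W v ⌋

  module _ {K W : Fin m → Bool} {k} {x : Fin m} {v : Vec (Fin m) k} (arr : IsArrangement K W (x ∷ v)) where

    private
      injective : ∀ u w → lookup (x ∷ v) u ≡ lookup (x ∷ v) w → u ≡ w
      injective = proj₁ arr
      inside : ∀ u → T (K (lookup (x ∷ v) u) ∨ W (lookup (x ∷ v) u))
      inside = proj₁ (proj₂ arr)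
      covers : ∀ i → T (K i) → ∃[ u ] lookup (x ∷ v) u ≡ i
      covers = proj₂ (proj₂ arr)

      tail-≢ : ∀ u → lookup v u ≢ x
      tail-≢ u eq with injective (fsuc u) fzero eq
      ... | ()

      covered-by-tail : ∀ i → T (K i) → i ≢ x → ∃[ u ] lookup v u ≡ i
      covered-by-tail i Ki i≢x with covers i Ki
      ... | fzero  , x≡i = ⊥-elim (i≢x (sym x≡i))
      ... | fsuc u , eq  = u , eq

    arrangement-head : T (K x ∨ W x)
    arrangement-head = inside fzero

    arrangement-tailᴷ : IsArrangement (remove K x) W v
    arrangement-tailᴷ =
      (λ u w eq → fsuc-injective (injective (fsuc u) (fsuc w) eq))
      , (λ u → from T-∨ (Data.Sum.map (λ Ky → from (T-remove K x _) (Ky , tail-≢ u)) (λ Wy → Wy)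
                                      (to T-∨ (inside (fsuc u)))))
      , (λ i Ki → let (Ki , i≢x) = to (T-remove K x i) Ki in covered-by-tail i Ki i≢x)

    arrangement-tailᵂ : ¬ T (K x) → IsArrangement K (remove W x) v
    arrangement-tailᵂ ¬Kx =
      (λ u w eq → fsuc-injective (injective (fsuc u) (fsuc w) eq))
      , (λ u → from T-∨ (Data.Sum.map (λ Ky → Ky) (λ Wy → from (T-remove W x _) (Wy , tail-≢ u))
                                      (to T-∨ (inside (fsuc u)))))
      , (λ i Ki → covered-by-tail i Ki (λ { refl → ¬Kx Ki }))

  module _ {k} (bound : ∀ K W → count (isArrangement K W) (allVec (allFin m) k) ≤ arrangements k (# K) (# W))
           (K W : Fin m → Bool) (x : Fin m) where

    private
      vs : List (Vec (Fin m) k)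
      vs = allVec (allFin m) k
      A B : ℕ
      A = arrangements k (# K ∸ 1) (# W)
      B = arrangements k (# K) (# W ∸ 1)

      -- K x and W x are matched through equations: `with` cannot abstract them, since they also
      -- occur inside the decision procedure isArrangement? K W (x ∷ v).
      by-head : ∀ {κ ω} → K x ≡ κ → W x ≡ ω →
        count (λ v → isArrangement K W (x ∷ v)) vs ≤ (if κ then A else 0) + (if ω then B else 0)
      by-head {true} Kx _ = begin
        count (λ v → isArrangement K W (x ∷ v)) vs
          ≤⟨ count-mono (λ v → fromWitness ∘ arrangement-tailᴷ {K = K} {W = W} ∘ toWitness) vs ⟩
        count (isArrangement (remove K x) W) vs
          ≤⟨ bound (remove K x) W ⟩
        arrangements k (# remove K x) (# W)
          ≡⟨ cong (λ a → arrangements k a (# W)) (#remove K (from T-≡ Kx)) ⟩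
        A
          ≤⟨ m≤m+n A _ ⟩
        A + _ ∎
        where open ≤-Reasoning
      by-head {false} {true} Kx Wx = begin
        count (λ v → isArrangement K W (x ∷ v)) vs
          ≤⟨ count-mono (λ v h → fromWitness (arrangement-tailᵂ {K = K} {W = W} (toWitness h) (subst T Kx))) vs ⟩
        count (isArrangement K (remove W x)) vs
          ≤⟨ bound K (remove W x) ⟩
        arrangements k (# K) (# remove W x)
          ≡⟨ cong (arrangements k (# K)) (#remove W (from T-≡ Wx)) ⟩
        B ∎
        where open ≤-Reasoning
      by-head {false} {false} Kx Wx = ≤-reflexive (count-none neither vs)
        where
        neither : ∀ v → ¬ T (isArrangement K W (x ∷ v))
        neither v h with to T-∨ (arrangement-head {K = K} {W = W} (toWitness h))
        ... | inj₁ Kx-holds = subst T Kx Kx-holds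
        ... | inj₂ Wx-holds = subst T Wx Wx-holds

    count-arrangements-with-head :
      count (isArrangement K W) (map (x ∷_) (allVec (allFin m) k))
      ≤ (if K x then arrangements k (# K ∸ 1) (# W) else 0) + (if W x then arrangements k (# K) (# W ∸ 1) else 0)
    count-arrangements-with-head = begin
      count (isArrangement K W) (map (x ∷_) vs)   ≡⟨ count-map (isArrangement K W) (x ∷_) vs ⟩
      count (λ v → isArrangement K W (x ∷ v)) vs  ≤⟨ by-head refl refl ⟩
      (if K x then A else 0) + (if W x then B else 0) ∎
      where open ≤-Reasoning

  count-arrangements : ∀ k (K W : Fin m → Bool) →
    count (isArrangement K W) (allVec (allFin m) k) ≤ arrangements k (# K) (# W)
  count-arrangements zero K W with # K in #K≡
  ... | zero  = length-filter (T? ∘ isArrangement K W) ([] ∷ [])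
  ... | suc _ = ≤-reflexive (count-none {p = isArrangement K W} (λ { [] h → empty-is-not (toWitness h) }) ([] ∷ []))
    where
    empty-is-not : ¬ IsArrangement K W []
    empty-is-not (_ , _ , covers) with count-witness K (allFin m) #K≡
    ... | i , Ki with covers i Ki
    ...   | () , _
  count-arrangements (suc k) K W = begin
    count (isArrangement K W) (concatMap (λ x → map (x ∷_) (allVec (allFin m) k)) (allFin m))
      ≤⟨ count-concatMap-≤ _ (λ x → map (x ∷_) (allVec (allFin m) k)) (λ x → (if K x then A else 0) + (if W x then B else 0))
           (count-arrangements-with-head {k} (count-arrangements k) K W) (allFin m) ⟩
    sum (map (λ x → (if K x then A else 0) + (if W x then B else 0)) (allFin m))
      ≡⟨ sum-+ _ _ (allFin m) ⟩
    sum (map (λ x → if K x then A else 0) (allFin m)) + sum (map (λ x → if W x then B else 0) (allFin m))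
      ≡⟨ cong₂ _+_ (sum-if K A (allFin m)) (sum-if W B (allFin m)) ⟩
    # K * A + # W * B ∎
    where
    open ≤-Reasoning
    A B : ℕ
    A = arrangements k (# K ∸ 1) (# W)
    B = arrangements k (# K) (# W ∸ 1)

T-allF : ∀ {k} (p : Fin k → Bool) → T (allF p) ⇔ (∀ i → T (p i))
T-allF {k} p = mk⇔ (λ h i → All.lookup (all⁺ p (allFin k) h) (∈-allFin i))
                   (λ h → all⁻ p {allFin k} (All.tabulate (λ {i} _ → h i)))

T-anyF : ∀ {k} (p : Fin k → Bool) → T (anyF p) ⇔ ∃ λ i → T (p i)
T-anyF {k} p = mk⇔ (λ h → satisfied (any⁻ p (allFin k) h)) (λ (i , pi) → any⁺ p (lose (∈-allFin i) pi))

T-==F : ∀ {k} (i j : Fin k) → T (i ==F j) ⇔ i ≡ j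
T-==F i j = mk⇔ (toℕ-injective ∘ ≡ᵇ⇒≡ (toℕ i) (toℕ j)) (≡⇒≡ᵇ (toℕ i) (toℕ j) ∘ cong toℕ)

T-not-∨ : ∀ a {b} → T (not a ∨ b) ⇔ (T a → T b)
T-not-∨ true  = mk⇔ (λ h _ → h) (λ h → h _)
T-not-∨ false = mk⇔ (λ _ ()) (λ _ → _)

T-∨-not : ∀ a b → T (a ∨ not b) ⇔ (T b → T a)
T-∨-not true  _     = mk⇔ (λ h _ → h) (λ _ → _)
T-∨-not false true  = mk⇔ (λ ()) (λ h → h _)
T-∨-not false false = mk⇔ (λ _ ()) (λ _ → _)

T-agree : ∀ a b → T ((a ∧ b) ∨ (not a ∧ not b)) ⇔ b ≡ a
T-agree true  true  = mk⇔ (λ _ → refl) (λ _ → _)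
T-agree true  false = mk⇔ (λ ()) (λ ())
T-agree false true  = mk⇔ (λ ()) (λ ())
T-agree false false = mk⇔ (λ _ → refl) (λ _ → _)

T-ext : ∀ {a b} → (T a → T b) → (T b → T a) → a ≡ b
T-ext {true}  {true}  _ _ = refl
T-ext {true}  {false} f _ = ⊥-elim (f _)
T-ext {false} {true}  _ g = ⊥-elim (g _)
T-ext {false} {false} _ _ = refl

lookup-ext : ∀ {A : Set} {k} {u v : Vec A k} → (∀ i → lookup u i ≡ lookup v i) → u ≡ v
lookup-ext {u = u} {v} u≗v = trans (sym (tabulate∘lookup u)) (trans (tabulate-cong u≗v) (tabulate∘lookup v))

module _ {m : ℕ} where

  IsSubgraphOf : (ℕ → ℕ → Bool) → VSub m → ESub m → Set
  IsSubgraphOf G S E = ∀ i j → T (inE E i j) →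
    toℕ i < toℕ j × T (inS S i) × T (inS S j) × T (G (label i) (label j))

  T-IsSubgraphᵇ : ∀ G S E → T (IsSubgraphᵇ G (S , E)) ⇔ IsSubgraphOf G S E
  T-IsSubgraphᵇ G S E = mk⇔
    (λ h i j e → unpack (to (T-not-∨ (inE E i j)) (to (T-allF _) (to (T-allF _) h i) j) e))
    (λ h → from (T-allF _) λ i → from (T-allF _) λ j → from (T-not-∨ (inE E i j)) (pack ∘ h i j))
    where
    unpack : ∀ {i j : Fin m} {a b c} → T ((toℕ i <ᵇ toℕ j) ∧ a ∧ b ∧ c) → toℕ i < toℕ j × T a × T b × T c
    unpack {i} {j} h with to T-∧ h
    ... | i<j , h′ with to T-∧ h′
    ...   | ta , h″ = <ᵇ⇒< (toℕ i) (toℕ j) i<j , ta , to T-∧ h″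
    pack : ∀ {i j : Fin m} {a b c} → toℕ i < toℕ j × T a × T b × T c → T ((toℕ i <ᵇ toℕ j) ∧ a ∧ b ∧ c)
    pack (i<j , ta , tb , tc) = from T-∧ (<⇒<ᵇ i<j , from T-∧ (ta , from T-∧ (tb , tc)))

record IsIsomorphism {n m} (F : Graph n) (S : VSub m) (E : ESub m) (φ : Vec (Fin m) n) : Set where
  field
    injective : ∀ u w → lookup φ u ≡ lookup φ w → u ≡ w
    image⊆S   : ∀ u → T (inS S (lookup φ u))
    S⊆image   : ∀ i → T (inS S i) → ∃[ u ] lookup φ u ≡ i
    edges     : ∀ u w → edgeE E (lookup φ u) (lookup φ w) ≡ adj F u w

module _ {n m} (F : Graph n) (S : VSub m) (E : ESub m) (φ : Vec (Fin m) n) where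

  private
    injectiveᵇ image⊆Sᵇ S⊆imageᵇ edgesᵇ : Bool
    injectiveᵇ = allF (λ u → allF (λ w → (u ==F w) ∨ not (lookup φ u ==F lookup φ w)))
    image⊆Sᵇ   = allF (λ u → inS S (lookup φ u))
    S⊆imageᵇ   = allF (λ i → not (inS S i) ∨ anyF (λ u → lookup φ u ==F i))
    edgesᵇ     = allF (λ u → allF (λ w →
                   (adj F u w ∧ edgeE E (lookup φ u) (lookup φ w))
                   ∨ (not (adj F u w) ∧ not (edgeE E (lookup φ u) (lookup φ w)))))

  isIsomorphismᵇ : Bool
  isIsomorphismᵇ = injectiveᵇ ∧ image⊆Sᵇ ∧ S⊆imageᵇ ∧ edgesᵇ

  T-isIsomorphismᵇ : T isIsomorphismᵇ ⇔ IsIsomorphism F S E φ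
  T-isIsomorphismᵇ = mk⇔ unpack pack
    where
    unpack : T isIsomorphismᵇ → IsIsomorphism F S E φ
    unpack h with to (T-∧ {injectiveᵇ}) h
    ... | inj , h′ with to (T-∧ {image⊆Sᵇ}) h′
    ...   | img , h″ with to (T-∧ {S⊆imageᵇ}) h″
    ...     | sur , edg = record
      { injective = λ u w eq → to (T-==F u w) (to (T-∨-not (u ==F w) _) (to (T-allF _) (to (T-allF _) inj u) w)
                                                (from (T-==F _ _) eq))
      ; image⊆S   = to (T-allF _) img
      ; S⊆image   = λ i i∈S → let (u , e) = to (T-anyF _) (to (T-not-∨ (inS S i)) (to (T-allF _) sur i) i∈S)
                               in u , to (T-==F _ _) e
      ; edges     = λ u w → to (T-agree (adj F u w) _) (to (T-allF _) (to (T-allF _) edg u) w)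
      }
    pack : IsIsomorphism F S E φ → T isIsomorphismᵇ
    pack iso = from T-∧ (inj , from T-∧ (img , from T-∧ (sur , edg)))
      where
      open IsIsomorphism iso
      inj : T injectiveᵇ
      inj = from (T-allF _) λ u → from (T-allF _) λ w → from (T-∨-not (u ==F w) _)
              λ e → from (T-==F u w) (injective u w (to (T-==F _ _) e))
      img : T image⊆Sᵇ
      img = from (T-allF _) image⊆S
      sur : T S⊆imageᵇ
      sur = from (T-allF _) λ i → from (T-not-∨ (inS S i)) λ i∈S →
              let (u , e) = S⊆image i i∈S in from (T-anyF _) (u , from (T-==F _ _) e)
      edg : T edgesᵇ
      edg = from (T-allF _) λ u → from (T-allF _) λ w → from (T-agree (adj F u w) _) (edges u w)

record Copy {n m} (F : Graph n) (G : ℕ → ℕ → Bool) (v : ℕ) (S : VSub m) (E : ESub m) : Set where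
  field
    subgraph     : IsSubgraphOf G S E
    vertex       : Fin m
    vertex∈S     : T (inS S vertex)
    label-vertex : label vertex ≡ v
    φ            : Vec (Fin m) n
    isomorphism  : IsIsomorphism F S E φ

module _ {n} (F : Graph n) (m : ℕ) (G : ℕ → ℕ → Bool) (v : ℕ) where

  isCopyᵇ : VSub m × ESub m → Bool
  isCopyᵇ (S , E) = IsSubgraphᵇ G (S , E) ∧ anyF (λ i → inS S i ∧ (label i ≡ᵇ v)) ∧ IsoToᵇ F (S , E)

  FDegree≡count : FDegree F m G v ≡ count isCopyᵇ (candidates m)
  FDegree≡count = refl

  T-isCopyᵇ : ∀ S E → T (isCopyᵇ (S , E)) ⇔ Copy F G v S E
  T-isCopyᵇ S E = mk⇔ unpack pack
    where
    unpack : T (isCopyᵇ (S , E)) → Copy F G v S E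
    unpack h with to (T-∧ {IsSubgraphᵇ G (S , E)}) h
    ... | sub , h′ with to (T-∧ {anyF (λ i → inS S i ∧ (label i ≡ᵇ v))}) h′
    ...   | has-v , iso with to (T-anyF _) has-v | satisfied (any⁻ (isIsomorphismᵇ F S E) (allVec (allFin m) n) iso)
    ...     | i , i∈S∧v | φ , φ-iso = record
      { subgraph     = to (T-IsSubgraphᵇ G S E) sub
      ; vertex       = i
      ; vertex∈S     = proj₁ (to T-∧ i∈S∧v)
      ; label-vertex = ≡ᵇ⇒≡ (label i) v (proj₂ (to (T-∧ {inS S i}) i∈S∧v))
      ; φ            = φ
      ; isomorphism  = to (T-isIsomorphismᵇ F S E φ) φ-iso
      }
    pack : Copy F G v S E → T (isCopyᵇ (S , E))
    pack c = from T-∧ (from (T-IsSubgraphᵇ G S E) subgraph , from T-∧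
               ( from (T-anyF _) (vertex , from T-∧ (vertex∈S , ≡⇒≡ᵇ (label vertex) v label-vertex))
               , any⁺ (isIsomorphismᵇ F S E) (lose (∈-allVec ∈-allFin φ) (from (T-isIsomorphismᵇ F S E φ) isomorphism))))
      where open Copy c

module _ {m} (E : ESub m) where

  edgeE-< : ∀ {i j : Fin m} → toℕ i < toℕ j → edgeE E i j ≡ inE E i j
  edgeE-< {i} {j} i<j rewrite to T-≡ (<⇒<ᵇ i<j) = refl

  edgeE-cases : ∀ i j → T (edgeE E i j) → T (inE E i j) ⊎ T (inE E j i)
  edgeE-cases i j h with toℕ i <ᵇ toℕ j | toℕ j <ᵇ toℕ i
  ... | true  | _    = inj₁ h
  ... | false | true = inj₂ h

module _ {n m} {F : Graph n} {S S′ : VSub m} {E E′ : ESub m} {φ : Vec (Fin m) n}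
         (iso : IsIsomorphism F S E φ) (iso′ : IsIsomorphism F S′ E′ φ) where

  open IsIsomorphism

  vertices-transfer : ∀ i → T (inS S i) → T (inS S′ i)
  vertices-transfer i i∈S with S⊆image iso i i∈S
  ... | u , refl = image⊆S iso′ u

  edges-transfer : ∀ {G} → IsSubgraphOf G S E → ∀ i j → T (inE E i j) → T (inE E′ i j)
  edges-transfer sub i j e with sub i j e
  ... | i<j , i∈S , j∈S , _ with S⊆image iso i i∈S | S⊆image iso j j∈S
  ...   | u , refl | w , refl =
    subst T (trans (sym (edgeE-< E i<j)) (trans (edges iso u w) (trans (sym (edges iso′ u w)) (edgeE-< E′ i<j)))) e

isomorphism-determines-subgraph :
  ∀ {n m} {F : Graph n} {G G′ : ℕ → ℕ → Bool} {S S′ : VSub m} {E E′ : ESub m} {φ : Vec (Fin m) n} →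
  IsSubgraphOf G S E → IsIsomorphism F S E φ → IsSubgraphOf G′ S′ E′ → IsIsomorphism F S′ E′ φ →
  (S , E) ≡ (S′ , E′)
isomorphism-determines-subgraph {G = G} {G′} sub iso sub′ iso′ = cong₂ _,_
  (lookup-ext λ i → T-ext (vertices-transfer iso iso′ i) (vertices-transfer iso′ iso i))
  (lookup-ext λ i → lookup-ext λ j →
    T-ext (edges-transfer iso iso′ {G} sub i j) (edges-transfer iso′ iso {G′} sub′ i j))

host-edge : ∀ {n m} {F : Graph n} {G : ℕ → ℕ → Bool} {S : VSub m} {E : ESub m} {φ : Vec (Fin m) n} →
  IsSubgraphOf G S E → IsIsomorphism F S E φ → ∀ u w → T (adj F u w) →
  T (G (label (lookup φ u)) (label (lookup φ w))) ⊎ T (G (label (lookup φ w)) (label (lookup φ u)))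
host-edge {E = E} sub iso u w uw with edgeE-cases E _ _ (subst T (sym (IsIsomorphism.edges iso u w)) uw)
... | inj₁ e = inj₁ (proj₂ (proj₂ (proj₂ (sub _ _ e))))
... | inj₂ e = inj₂ (proj₂ (proj₂ (proj₂ (sub _ _ e))))

module _ {m : ℕ} where

  last-or-inject₁ : (i : Fin (suc m)) → i ≡ fromℕ m ⊎ ∃[ j ] inject₁ j ≡ i
  last-or-inject₁ i with m ≟ℕ toℕ i
  ... | yes m≡i = inj₁ (toℕ-injective (trans (sym m≡i) (sym (toℕ-fromℕ m))))
  ... | no  m≢i = inj₂ (lower₁ i m≢i , inject₁-lower₁ i m≢i)

  containsLast : VSub (suc m) × ESub (suc m) → Bool
  containsLast (S , E) = inS S (fromℕ m)

  restrictⱽ : VSub (suc m) → VSub m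
  restrictⱽ S = tabulate (λ i → inS S (inject₁ i))

  restrictᴱ : ESub (suc m) → ESub m
  restrictᴱ E = tabulate (λ i → tabulate (λ j → inE E (inject₁ i) (inject₁ j)))

  inS-restrict : ∀ S i → inS (restrictⱽ S) i ≡ inS S (inject₁ i)
  inS-restrict S i = lookup∘tabulate _ i

  inE-restrict : ∀ E i j → inE (restrictᴱ E) i j ≡ inE E (inject₁ i) (inject₁ j)
  inE-restrict E i j rewrite lookup∘tabulate (λ i → tabulate (λ j → inE E (inject₁ i) (inject₁ j))) i =
    lookup∘tabulate _ j

  edgeE-restrict : ∀ E i j → edgeE (restrictᴱ E) i j ≡ edgeE E (inject₁ i) (inject₁ j)
  edgeE-restrict E i j rewrite toℕ-inject₁ i | toℕ-inject₁ j | inE-restrict E i j | inE-restrict E j i = refl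

  copy-restrict : ∀ {n} {F : Graph n} {G G′ : ℕ → ℕ → Bool} {v S E} →
    (∀ a b → a ≤ m → b ≤ m → T (G a b) → T (G′ a b)) → ¬ T (inS S (fromℕ m)) →
    Copy F G v S E → Copy F G′ v (restrictⱽ S) (restrictᴱ E)
  copy-restrict {n} {F} {G} {G′} {v} {S} {E} G⇒G′ last∉S c = record
    { subgraph     = subgraph′
    ; vertex       = lower₁ vertex (not-last vertex∈S)
    ; vertex∈S     = subst T (sym (trans (inS-restrict S _) (cong (inS S) (inject₁-lower₁ vertex _)))) vertex∈S
    ; label-vertex = trans (cong suc (toℕ-lower₁ vertex _)) label-vertex
    ; φ            = φ′
    ; isomorphism  = isomorphism′
    }
    where
    open Copy c
    open IsIsomorphism isomorphism
    not-last : ∀ {i} → T (inS S i) → m ≢ toℕ i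
    not-last {i} i∈S m≡i = last∉S (subst (T ∘ inS S) (toℕ-injective (trans (sym m≡i) (sym (toℕ-fromℕ m)))) i∈S)
    φ′ : Vec (Fin m) n
    φ′ = tabulate λ u → lower₁ (lookup φ u) (not-last (image⊆S u))
    inject₁-φ′ : ∀ u → inject₁ (lookup φ′ u) ≡ lookup φ u
    inject₁-φ′ u rewrite lookup∘tabulate (λ u → lower₁ (lookup φ u) (not-last (image⊆S u))) u =
      inject₁-lower₁ (lookup φ u) _
    subgraph′ : IsSubgraphOf G′ (restrictⱽ S) (restrictᴱ E)
    subgraph′ i j e with subgraph (inject₁ i) (inject₁ j) (subst T (inE-restrict E i j) e)
    ... | i<j , i∈S , j∈S , ij∈G =
      subst₂ _<_ (toℕ-inject₁ i) (toℕ-inject₁ j) i<j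
      , subst T (sym (inS-restrict S i)) i∈S
      , subst T (sym (inS-restrict S j)) j∈S
      , G⇒G′ _ _ (toℕ<n i) (toℕ<n j) (subst₂ (λ a b → T (G (suc a) (suc b))) (toℕ-inject₁ i) (toℕ-inject₁ j) ij∈G)
    isomorphism′ : IsIsomorphism F (restrictⱽ S) (restrictᴱ E) φ′
    isomorphism′ = record
      { injective = λ u w eq → injective u w (trans (sym (inject₁-φ′ u)) (trans (cong inject₁ eq) (inject₁-φ′ w)))
      ; image⊆S   = λ u → subst T (sym (trans (inS-restrict S _) (cong (inS S) (inject₁-φ′ u)))) (image⊆S u)
      ; S⊆image   = λ i i∈S′ → let (u , φu≡i) = S⊆image (inject₁ i) (subst T (inS-restrict S i) i∈S′)
                                in u , inject₁-injective (trans (inject₁-φ′ u) φu≡i)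
      ; edges     = λ u w → trans (edgeE-restrict E (lookup φ′ u) (lookup φ′ w))
                              (trans (cong₂ (edgeE E) (inject₁-φ′ u) (inject₁-φ′ w)) (edges u w))
      }

  edge-avoids-last : ∀ {G S E} → IsSubgraphOf G S E → ¬ T (inS S (fromℕ m)) →
    ∀ i j → T (inE E i j) → i ≢ fromℕ m × j ≢ fromℕ m
  edge-avoids-last sub last∉S i j e with sub i j e
  ... | _ , i∈S , j∈S , _ = (λ { refl → last∉S i∈S }) , (λ { refl → last∉S j∈S })

  restrict-injective : ∀ {G₁ G₂ S₁ E₁ S₂ E₂} → IsSubgraphOf G₁ S₁ E₁ → IsSubgraphOf G₂ S₂ E₂ →
    ¬ T (inS S₁ (fromℕ m)) → ¬ T (inS S₂ (fromℕ m)) →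
    restrictⱽ S₁ ≡ restrictⱽ S₂ → restrictᴱ E₁ ≡ restrictᴱ E₂ → (S₁ , E₁) ≡ (S₂ , E₂)
  restrict-injective {G₁} {G₂} {S₁} {E₁} {S₂} {E₂} sub₁ sub₂ last∉S₁ last∉S₂ S₁≈S₂ E₁≈E₂ =
    cong₂ _,_ (lookup-ext same-vertex) (lookup-ext λ i → lookup-ext (same-edge i))
    where
    same-vertex : ∀ i → inS S₁ i ≡ inS S₂ i
    same-vertex i with last-or-inject₁ i
    ... | inj₁ refl        = T-ext (⊥-elim ∘ last∉S₁) (⊥-elim ∘ last∉S₂)
    ... | inj₂ (i′ , refl) =
      trans (sym (inS-restrict S₁ i′)) (trans (cong (λ S → inS S i′) S₁≈S₂) (inS-restrict S₂ i′))
    avoids₁ : ∀ i j → T (inE E₁ i j) → i ≢ fromℕ m × j ≢ fromℕ m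
    avoids₁ = edge-avoids-last {G₁} {S₁} {E₁} sub₁ last∉S₁
    avoids₂ : ∀ i j → T (inE E₂ i j) → i ≢ fromℕ m × j ≢ fromℕ m
    avoids₂ = edge-avoids-last {G₂} {S₂} {E₂} sub₂ last∉S₂
    same-edge : ∀ i j → inE E₁ i j ≡ inE E₂ i j
    same-edge i j with last-or-inject₁ i | last-or-inject₁ j
    ... | inj₁ refl | _ =
      T-ext (λ e → ⊥-elim (proj₁ (avoids₁ i j e) refl)) (λ e → ⊥-elim (proj₁ (avoids₂ i j e) refl))
    ... | inj₂ _ | inj₁ refl =
      T-ext (λ e → ⊥-elim (proj₂ (avoids₁ i j e) refl)) (λ e → ⊥-elim (proj₂ (avoids₂ i j e) refl))
    ... | inj₂ (i′ , refl) | inj₂ (j′ , refl) =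
      trans (sym (inE-restrict E₁ i′ j′)) (trans (cong (λ E → inE E i′ j′) E₁≈E₂) (inE-restrict E₂ i′ j′))

copies-avoiding-last : ∀ {n m} (F : Graph n) {G G′ : ℕ → ℕ → Bool} v →
  (∀ a b → a ≤ m → b ≤ m → T (G a b) → T (G′ a b)) →
  count (λ SE → isCopyᵇ F (suc m) G v SE ∧ not (containsLast SE)) (candidates (suc m)) ≤ FDegree F m G′ v
copies-avoiding-last {n} {m} F {G} {G′} v G⇒G′ =
  count-≤-injection (candidates-unique (suc m)) ∈-candidates
    (λ (S , E) _ → restrictⱽ S , restrictᴱ E)
    (λ (S , E) h → let (c , last∉S) = unpack {S} {E} h in from (T-isCopyᵇ F m G′ v _ _) (copy-restrict G⇒G′ last∉S c))
    (λ (S₁ , E₁) (S₂ , E₂) h₁ h₂ eq →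
      let (c₁ , last∉S₁) = unpack {S₁} {E₁} h₁ ; (c₂ , last∉S₂) = unpack {S₂} {E₂} h₂
      in restrict-injective {G₁ = G} {G₂ = G} (Copy.subgraph c₁) (Copy.subgraph c₂) last∉S₁ last∉S₂
           (cong proj₁ eq) (cong proj₂ eq))
  where
  unpack : ∀ {S E} → T (isCopyᵇ F (suc m) G v (S , E) ∧ not (inS S (fromℕ m))) →
    Copy F G v S E × ¬ T (inS S (fromℕ m))
  unpack {S} {E} h with to (T-∧ {isCopyᵇ F (suc m) G v (S , E)}) h
  ... | copy , last∉S = to (T-isCopyᵇ F (suc m) G v S E) copy , subst T (to T-not-≡ last∉S)

-- The host graph F_{2l}, with 2l written as suc m

module _ (l t m : ℕ) (2l≡1+m : 2 * l ≡ suc m) where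

  F-adj-cases : ∀ a b → T (F-adj l t a b) →
    (a ≤ m × b ≤ m × ∣ a - b ∣ ≤ l ∸ 1) ⊎ (a ≡ suc m × b ≤ t) ⊎ (b ≡ suc m × a ≤ t)
  F-adj-cases a b h with to T-∨ (proj₂ (to T-∧ h))
  ... | inj₁ near with to T-∧ near
  ...   | a≤ , rest with to T-∧ rest
  ...     | b≤ , d = inj₁ (below-top a≤ , below-top b≤ , ≤ᵇ⇒≤ _ _ d)
    where
    below-top : ∀ {x} → T (x Data.Nat.≤ᵇ 2 * l ∸ 1) → x ≤ m
    below-top {x} h = subst (x ≤_) (cong (_∸ 1) 2l≡1+m) (≤ᵇ⇒≤ _ _ h)
  F-adj-cases a b h | inj₂ far with to T-∨ far
  ... | inj₁ top-a with to T-∧ top-a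
  ...   | a≡ , rest = inj₂ (inj₁ (trans (≡ᵇ⇒≡ a _ a≡) 2l≡1+m , ≤ᵇ⇒≤ _ _ (proj₂ (to T-∧ rest))))
  F-adj-cases a b h | inj₂ far | inj₂ top-b with to T-∧ top-b
  ... | b≡ , rest = inj₂ (inj₂ (trans (≡ᵇ⇒≡ b _ b≡) 2l≡1+m , ≤ᵇ⇒≤ _ _ (proj₂ (to T-∧ rest))))

  F-adj⇒A-adj : ∀ a b → a ≤ m → b ≤ m → T (F-adj l t a b) → T (A-adj l a b)
  F-adj⇒A-adj a b a≤m b≤m h with F-adj-cases a b h
  ... | inj₁ (_ , _ , d)       = from T-∧ (proj₁ (to T-∧ h) , ≤⇒≤ᵇ d)
  ... | inj₂ (inj₁ (refl , _)) = ⊥-elim (1+n≰n a≤m)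
  ... | inj₂ (inj₂ (refl , _)) = ⊥-elim (1+n≰n b≤m)

  HostEdge : ℕ → ℕ → Set
  HostEdge a b = T (F-adj l t a b) ⊎ T (F-adj l t b a)

  module _ (t≤m : t ≤ m) where

    top-neighbour : ∀ {b} → HostEdge (suc m) b → b ≤ t
    top-neighbour {b} (inj₁ h) with F-adj-cases (suc m) b h
    ... | inj₁ (1+m≤m , _)        = ⊥-elim (1+n≰n 1+m≤m)
    ... | inj₂ (inj₁ (_ , b≤t))   = b≤t
    ... | inj₂ (inj₂ (_ , 1+m≤t)) = ⊥-elim (1+n≰n (≤-trans 1+m≤t t≤m))
    top-neighbour {b} (inj₂ h) with F-adj-cases b (suc m) h
    ... | inj₁ (_ , 1+m≤m , _)    = ⊥-elim (1+n≰n 1+m≤m)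
    ... | inj₂ (inj₁ (_ , 1+m≤t)) = ⊥-elim (1+n≰n (≤-trans 1+m≤t t≤m))
    ... | inj₂ (inj₂ (_ , b≤t))   = b≤t

    low-neighbour : ∀ {a b} → HostEdge a b → b ≤ t → a ≡ suc m ⊎ a ≤ t + (l ∸ 1)
    low-neighbour {a} {b} (inj₁ h) b≤t with F-adj-cases a b h
    ... | inj₁ (_ , _ , d)        = inj₂ (≤-trans (m≤n+∣m-n∣ a b) (+-mono-≤ b≤t d))
    ... | inj₂ (inj₁ (a≡1+m , _)) = inj₁ a≡1+m
    ... | inj₂ (inj₂ (refl , _))  = ⊥-elim (1+n≰n (≤-trans b≤t t≤m))
    low-neighbour {a} {b} (inj₂ h) b≤t with F-adj-cases b a h
    ... | inj₁ (_ , _ , d)        = inj₂ (≤-trans (m≤n+∣m-n∣ a b) (+-mono-≤ b≤t (subst (_≤ l ∸ 1) (∣-∣-comm b a) d)))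
    ... | inj₂ (inj₁ (refl , _))  = ⊥-elim (1+n≰n (≤-trans b≤t t≤m))
    ... | inj₂ (inj₂ (a≡1+m , _)) = inj₁ a≡1+m

-- Vertex i has label toℕ i + 1; with p = l − 1 and m = 2l − 1, forced i and allowed i hold for
-- the labels {1, …, t, l, 2l} and {1, …, t + l − 1, 2l} respectively.
module _ (t p m : ℕ) where

  forced allowed optional : Fin (suc m) → Bool
  forced i   = below t i ∨ is p i ∨ is m i
  allowed i  = below (t + p) i ∨ is m i
  optional i = allowed i ∧ not (forced i)

  #forced : t ≤ p → p < m → # forced ≡ t + 2
  #forced t≤p p<m = begin
    # forced
      ≡⟨ count-∨ low-vs-marked (allFin (suc m)) ⟩
    # below {suc m} t + # (λ (i : Fin (suc m)) → is p i ∨ is m i)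
      ≡⟨ cong₂ _+_ (#below t (≤-trans t≤p (≤-trans (<⇒≤ p<m) (n≤1+n m))))
                   (count-∨ p-vs-m (allFin (suc m))) ⟩
    t + (# is {suc m} p + # is {suc m} m)
      ≡⟨ cong (t +_) (cong₂ _+_ (#is p (<-trans p<m (n<1+n m))) (#is m (n<1+n m))) ⟩
    t + 2 ∎
    where
    open ≡-Reasoning
    low-vs-marked : ∀ i → T (below t i) → ¬ T (is p i ∨ is m i)
    low-vs-marked i i<t h with to T-∨ h
    ... | inj₁ i≡p = <⇒≱ (below⇒< i i<t) (subst (t ≤_) (sym (is⇒≡ i i≡p)) t≤p)
    ... | inj₂ i≡m = <⇒≱ (below⇒< i i<t) (subst (t ≤_) (sym (is⇒≡ i i≡m)) (≤-trans t≤p (<⇒≤ p<m)))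
    p-vs-m : ∀ i → T (is p i) → ¬ T (is m i)
    p-vs-m i i≡p i≡m = <⇒≢ p<m (trans (sym (is⇒≡ i i≡p)) (is⇒≡ i i≡m))

  #allowed : t + p ≤ m → # allowed ≡ t + p + 1
  #allowed t+p≤m = begin
    # allowed                                ≡⟨ count-∨ low-vs-last (allFin (suc m)) ⟩
    # below {suc m} (t + p) + # is {suc m} m ≡⟨ cong₂ _+_ (#below (t + p) (≤-trans t+p≤m (n≤1+n m))) (#is m (n<1+n m)) ⟩
    t + p + 1                                ∎
    where
    open ≡-Reasoning
    low-vs-last : ∀ i → T (below (t + p) i) → ¬ T (is m i)
    low-vs-last i i<t+p i≡m = <⇒≱ (below⇒< i i<t+p) (subst (t + p ≤_) (sym (is⇒≡ i i≡m)) t+p≤m)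

  forced⇒allowed : 1 ≤ t → ∀ i → T (forced i) → T (allowed i)
  forced⇒allowed 1≤t i forced-i with to T-∨ forced-i
  ... | inj₁ i<t = from T-∨ (inj₁ (<⇒<ᵇ (<-≤-trans (below⇒< i i<t) (m≤m+n t p))))
  ... | inj₂ rest with to T-∨ rest
  ...   | inj₁ i≡p = from T-∨ (inj₁ (<⇒<ᵇ (subst (_< t + p) (sym (is⇒≡ i i≡p)) (m<n+m p 1≤t))))
  ...   | inj₂ i≡m = from T-∨ (inj₂ i≡m)

  #optional : 1 ≤ t → t ≤ p → p < m → t + p ≤ m → # optional ≡ p ∸ 1
  #optional 1≤t t≤p p<m t+p≤m = +-cancelʳ-≡ (t + 2) (# optional) (p ∸ 1) (begin
    # optional + (t + 2)                         ≡⟨ cong (# optional +_) (#forced t≤p p<m) ⟨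
    # optional + # forced                        ≡⟨ cong (# optional +_) (count-cong (allFin (suc m)) λ i _ →
                                                      absorb (allowed i) (forced i) (forced⇒allowed 1≤t i)) ⟨
    # optional + # (λ i → allowed i ∧ forced i)  ≡⟨ count-split allowed forced (allFin (suc m)) ⟨
    # allowed                                    ≡⟨ #allowed t+p≤m ⟩
    t + p + 1                                    ≡⟨ rearrange p (≤-trans 1≤t t≤p) ⟩
    p ∸ 1 + (t + 2)                              ∎)
    where
    open ≡-Reasoning
    absorb : ∀ a f → (T f → T a) → a ∧ f ≡ f
    absorb a     false _   = ∧-zeroʳ a
    absorb true  true  _   = refl
    absorb false true  f⇒a = ⊥-elim (f⇒a _)
    rearrange : ∀ p → 1 ≤ p → t + p + 1 ≡ p ∸ 1 + (t + 2)
    rearrange (suc p) _ = lemma t p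
      where
      lemma : ∀ t p → t + suc p + 1 ≡ p + (t + 2)
      lemma = solve-∀

DiameterAtMost2 : ∀ {n} → Graph n → Set
DiameterAtMost2 {n} F =
  ∀ u v → u ≢ v → (adj F u v ≡ true) ⊎ (∃[ w ] (adj F u w ≡ true × adj F w v ≡ true))

module _ {n} (F : Graph n) (diameter≤2 : DiameterAtMost2 F) {t l m : ℕ} (2l≡1+m : 2 * l ≡ suc m)
         (t≤degree : ∀ v → t ≤ degree F v) (1≤t : 1 ≤ t) (t<l : t < l) where

  private
    p : ℕ
    p = l ∸ 1

    t≤p : t ≤ p
    t≤p = ∸-monoˡ-≤ 1 t<l

    l+p≡m : l + p ≡ m
    l+p≡m = halve l 2l≡1+m (≤-trans 1≤t (<⇒≤ t<l))
      where
      halve : ∀ l → 2 * l ≡ suc m → 1 ≤ l → l + (l ∸ 1) ≡ m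
      halve (suc l′) eq _ = trans (lemma l′) (suc-injective eq)
        where
        lemma : ∀ l → suc l + l ≡ l + suc (l + 0)
        lemma = solve-∀

    t+p≤m : t + p ≤ m
    t+p≤m = subst (t + p ≤_) l+p≡m (+-monoˡ-≤ p (<⇒≤ t<l))

    p<m : p < m
    p<m = <-≤-trans (m<n+m p 1≤t) t+p≤m

    t≤m : t ≤ m
    t≤m = ≤-trans t≤p (<⇒≤ p<m)

  module _ {S E} (c : Copy F (F-adj l t) l S E) (last∈S : T (inS S (fromℕ m))) where

    open Copy c
    open IsIsomorphism isomorphism

    private
      top : Fin n
      top = proj₁ (S⊆image _ last∈S)

      φ-top : lookup φ top ≡ fromℕ m
      φ-top = proj₂ (S⊆image _ last∈S)

      edge : ∀ u w → T (adj F u w) → HostEdge l t m 2l≡1+m (label (lookup φ u)) (label (lookup φ w))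
      edge = host-edge {G = F-adj l t} subgraph isomorphism

      top-neighbour-low : ∀ w → T (adj F top w) → toℕ (lookup φ w) < t
      top-neighbour-low w top-w = top-neighbour l t m 2l≡1+m t≤m
        (subst (λ a → HostEdge l t m 2l≡1+m a (label (lookup φ w)))
               (cong suc (trans (cong toℕ φ-top) (toℕ-fromℕ m))) (edge top w top-w))

      low-in-image : ∀ i → toℕ i < t → ∃[ u ] lookup φ u ≡ i
      low-in-image i i<t =
        let (u , _ , φu≡i) = onto-by-counting (adj F top) (below t) (lookup φ)
                               (λ w top-w → <⇒<ᵇ (top-neighbour-low w top-w)) (λ u w _ _ → injective u w)
                               (subst (_≤ degree F top) (sym (#below t (≤-trans t≤m (n≤1+n m)))) (t≤degree top))
                               i (<⇒<ᵇ i<t)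
        in u , φu≡i

      in-range : ∀ u → toℕ (lookup φ u) < t + p ⊎ toℕ (lookup φ u) ≡ m
      in-range u with u ≟ top
      ... | yes refl = inj₂ (trans (cong toℕ φ-top) (toℕ-fromℕ m))
      ... | no u≢top with diameter≤2 top u (u≢top ∘ sym)
      ...   | inj₁ top-u = inj₁ (<-≤-trans (top-neighbour-low u (from T-≡ top-u)) (m≤m+n t p))
      ...   | inj₂ (w , top-w , w-u)
              with low-neighbour l t m 2l≡1+m t≤m (swap (edge w u (from T-≡ w-u))) (top-neighbour-low w (from T-≡ top-w))
      ...     | inj₁ φu≡last = inj₂ (suc-injective φu≡last)
      ...     | inj₂ φu≤t+p  = inj₁ φu≤t+p

    image-is-arrangement : IsArrangement (forced t p m) (optional t p m) φ
    image-is-arrangement = injective , inside , covered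
      where
      extend : ∀ f a → T a → T (f ∨ (a ∧ not f))
      extend true  _    _ = _
      extend false true _ = _
      inside : ∀ u → T (forced t p m (lookup φ u) ∨ optional t p m (lookup φ u))
      inside u = extend (forced t p m (lookup φ u)) _ (from T-∨ (Data.Sum.map <⇒<ᵇ (≡⇒≡ᵇ _ m) (in-range u)))
      covered : ∀ i → T (forced t p m i) → ∃[ u ] lookup φ u ≡ i
      covered i forced-i with to T-∨ forced-i
      ... | inj₁ i<t = low-in-image i (below⇒< i i<t)
      ... | inj₂ rest with to T-∨ rest
      ...   | inj₁ i≡p = let (u , φu≡vertex) = S⊆image vertex vertex∈S in
                         u , trans φu≡vertex (toℕ-injective (trans (cong (_∸ 1) label-vertex) (sym (is⇒≡ i i≡p))))
      ...   | inj₂ i≡m = top , trans φ-top (toℕ-injective (trans (toℕ-fromℕ m) (sym (is⇒≡ i i≡m))))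

  copies-through-last :
    count (λ SE → isCopyᵇ F (suc m) (F-adj l t) l SE ∧ containsLast SE) (candidates (suc m))
    ≤ arrangements n (t + 2) (l ∸ 2)
  copies-through-last = begin
    count (λ SE → isCopyᵇ F (suc m) (F-adj l t) l SE ∧ containsLast SE) (candidates (suc m))
      ≤⟨ count-≤-injection (candidates-unique (suc m)) (∈-allVec ∈-allFin)
           (λ (S , E) h → Copy.φ (proj₁ (unpack {S} {E} h)))
           (λ (S , E) h → let (c , last∈S) = unpack {S} {E} h in fromWitness (image-is-arrangement c last∈S))
           (λ (S₁ , E₁) (S₂ , E₂) h₁ h₂ φ₁≡φ₂ →
              let c₁ = proj₁ (unpack {S₁} {E₁} h₁) ; c₂ = proj₁ (unpack {S₂} {E₂} h₂)
              in isomorphism-determines-subgraph {G = F-adj l t} {G′ = F-adj l t}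
                   (Copy.subgraph c₁) (Copy.isomorphism c₁)
                   (Copy.subgraph c₂) (subst (IsIsomorphism F S₂ E₂) (sym φ₁≡φ₂) (Copy.isomorphism c₂))) ⟩
    count (isArrangement (forced t p m) (optional t p m)) (allVec (allFin (suc m)) n)
      ≤⟨ count-arrangements n (forced t p m) (optional t p m) ⟩
    arrangements n (# forced t p m) (# optional t p m)
      ≡⟨ cong₂ (arrangements n) (#forced t p m t≤p p<m) (#optional t p m 1≤t t≤p p<m t+p≤m) ⟩
    arrangements n (t + 2) (l ∸ 1 ∸ 1)
      ≡⟨ cong (arrangements n (t + 2)) (∸-+-assoc l 1 1) ⟩
    arrangements n (t + 2) (l ∸ 2) ∎
    where
    open ≤-Reasoning
    unpack : ∀ {S E} → T (isCopyᵇ F (suc m) (F-adj l t) l (S , E) ∧ inS S (fromℕ m)) →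
      Copy F (F-adj l t) l S E × T (inS S (fromℕ m))
    unpack {S} {E} h with to (T-∧ {isCopyᵇ F (suc m) (F-adj l t) l (S , E)}) h
    ... | copy , last∈S = to (T-isCopyᵇ F (suc m) (F-adj l t) l S E) copy , last∈S


module _ {n} (F : Graph n) where

  degree<n : ∀ v → degree F v < n
  degree<n v = subst (degree F v <_) (length-tabulate (λ i → i))
    (filter-notAll (λ x → T? (adj F v x)) (allFin n) (lose (∈-allFin v) (subst T (irrfl F v))))

  1≤degree : DiameterAtMost2 F → ∀ {u w} → u ≢ w → ∀ v → 1 ≤ degree F v
  1≤degree diameter≤2 {u} {w} u≢w v =
    filter-some (λ x → T? (adj F v x)) (lose (∈-allFin (proj₁ neighbour)) (proj₂ neighbour))
    where
    other : ∃[ x ] v ≢ x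
    other with u ≟ v
    ... | yes refl = w , u≢w
    ... | no  u≢v  = u , λ v≡u → u≢v (sym v≡u)
    neighbour : ∃[ x ] T (adj F v x)
    neighbour with diameter≤2 v (proj₁ other) (proj₂ other)
    ... | inj₁ v-x           = proj₁ other , from T-≡ v-x
    ... | inj₂ (x , v-x , _) = x , from T-≡ v-x

open import Data.Integer using (+_; _-_)
open import Data.Integer.Properties using ([+m]-[+n]≡m⊖n; ⊖-≥)

+a-+b≡+[a∸b] : ∀ {a b} → b ≤ a → + a - + b ≡ + (a ∸ b)
+a-+b≡+[a∸b] {a} {b} b≤a = trans ([+m]-[+n]≡m⊖n a b) (⊖-≥ b≤a)

arrangements≤n!*Cℤ : ∀ n t l → 2 ≤ l → arrangements n (t + 2) (l ∸ 2) ≤ n ! * Cℤ (+ l - + 2) (+ n - + t - + 2)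
arrangements≤n!*Cℤ n t l 2≤l with t + 2 ≤? n
... | no  t+2≰n = ≤-trans (≤-reflexive (arrangements-< (l ∸ 2) (≰⇒> t+2≰n))) z≤n
... | yes t+2≤n = ≤-reflexive (begin
  arrangements n (t + 2) (l ∸ 2)            ≡⟨ cong (λ k → arrangements k (t + 2) (l ∸ 2)) (m+[n∸m]≡n t+2≤n) ⟨
  arrangements (t + 2 + j) (t + 2) (l ∸ 2)  ≡⟨ arrangements-+ (t + 2) j (l ∸ 2) ⟩
  (t + 2 + j) ! * ((l ∸ 2) C j)             ≡⟨ cong (λ k → k ! * ((l ∸ 2) C j)) (m+[n∸m]≡n t+2≤n) ⟩
  n ! * ((l ∸ 2) C j)                       ≡⟨ cong (n ! *_) (cong₂ Cℤ (+a-+b≡+[a∸b] 2≤l) n-t-2≡j) ⟨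
  n ! * Cℤ (+ l - + 2) (+ n - + t - + 2)    ∎)
  where
  open ≡-Reasoning
  j : ℕ
  j = n ∸ (t + 2)
  n-t-2≡j : + n - + t - + 2 ≡ + j
  n-t-2≡j = begin
    + n - + t - + 2  ≡⟨ cong (_- + 2) (+a-+b≡+[a∸b] (≤-trans (m≤m+n t 2) t+2≤n)) ⟩
    + (n ∸ t) - + 2  ≡⟨ +a-+b≡+[a∸b] (subst (_≤ n ∸ t) (m+n∸m≡n t 2) (∸-monoˡ-≤ t t+2≤n)) ⟩
    + (n ∸ t ∸ 2)    ≡⟨ cong +_ (∸-+-assoc n t 2) ⟩
    + j              ∎

lemma7 : ∀ {n} (F : Graph n) (t l : ℕ) → HasDiameter2 F → IsMinDegree F t → n < l →
    FDegree F (2 * l) (F-adj l t) l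
      ≤ FDegree F (2 * l Data.Nat.∸ 1) (A-adj l) l + n ! * Cℤ (+ l - + 2) (+ n - + t - + 2)
lemma7 F t zero _ _ ()
lemma7 {n} F t l@(suc p) (diameter≤2 , (u , w , u≢w , _)) ((v₀ , degree-v₀≡t) , t≤degree) n<l = begin
  FDegree F (2 * l) (F-adj l t) l
    ≡⟨ FDegree≡count F (2 * l) (F-adj l t) l ⟩
  count copy (candidates (2 * l))
    ≡⟨ count-split copy containsLast (candidates (2 * l)) ⟩
  count (λ SE → copy SE ∧ not (containsLast SE)) (candidates (2 * l))
    + count (λ SE → copy SE ∧ containsLast SE) (candidates (2 * l))
    ≤⟨ +-mono-≤ (copies-avoiding-last F l (F-adj⇒A-adj l t m refl))
                (copies-through-last F diameter≤2 refl t≤degree 1≤t t<l) ⟩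
  FDegree F m (A-adj l) l + arrangements n (t + 2) (l ∸ 2)
    ≤⟨ +-monoʳ-≤ _ (arrangements≤n!*Cℤ n t l (s≤s (≤-trans 1≤t (≤-pred t<l)))) ⟩
  FDegree F m (A-adj l) l + n ! * Cℤ (+ l - + 2) (+ n - + t - + 2) ∎
  where
  open ≤-Reasoning
  -- Chosen so that 2 * l and 2 * l ∸ 1 reduce to suc m and m.
  m : ℕ
  m = p + suc (p + 0)
  copy : VSub (2 * l) × ESub (2 * l) → Bool
  copy = isCopyᵇ F (2 * l) (F-adj l t) l
  1≤t : 1 ≤ t
  1≤t = subst (1 ≤_) degree-v₀≡t (1≤degree F diameter≤2 u≢w v₀)
  t<l : t < l
  t<l = <-trans (subst (_< n) degree-v₀≡t (degree<n F v₀)) n<l
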